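{- Let $G_1,\dots,G_m$ be pairwise disjoint finite simple graphs, and let $j$ be the number of indices $i\in\{1,\dots,m\}$ such that $\rho(G_i)$ is odd. Then $\nu(G_1\oplus\cdots\oplus G_m)=\sum_{i=1}^m \nu(G_i)$ if $j=0$, and $\nu(G_1\oplus\cdots\oplus G_m)=\sum_{i=1}^m \nu(G_i)+j-1$ otherwise.
   Context: For a finite simple graph $G$ with $V(G)=\{v_1,\dots,v_n\}$, the closed neighborhood matrix $N(G)$ is the $n\times n$ matrix over $\mathbb{Z}_2$ whose $i$-th column is the characteristic vector of $N[v_i]=\{w : w \text{ adjacent to } v_i \text{ or } w=v_i\}$. The rank $\rho(G)$ and nullity $\nu(G)$ are the dimensions over $\mathbb{Z}_2$ of the column space and kernel of $N(G)$. The join $G_1\oplus\cdots\oplus G_m$ of pairwise disjoint graphs has vertex set $\bigcup_{i=1}^m V(G_i)$ and edge set $\bigcup_{i=1}^m E(G_i)\cup\{uv : u\in V(G_k), v\in V(G_l), k\neq l\}$. -}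

module Defs where

open import Data.Nat using (ℕ; zero; suc; _+_; _%_)
open import Data.Bool using (Bool; true; false; _xor_; _∧_; _∨_; if_then_else_)
open import Data.Fin using (Fin; zero; suc; splitAt; _≟_)
open import Data.Sum using (_⊎_; inj₁; inj₂)
open import Data.Product using (Σ; ∃; _×_; _,_)
open import Relation.Binary.PropositionalEquality using (_≡_; refl)
open import Relation.Nullary using (does)

record Graph : Set where
  field
    n      : ℕ
    adj    : Fin n → Fin n → Bool
    sym    : ∀ u v → adj u v ≡ adj v u
    irrefl : ∀ v → adj v v ≡ false
open Graph public

-- Linear algebra over ℤ₂ (Bool with xor as +, ∧ as ·)

⊕Σ : ∀ {k} → (Fin k → Bool) → Bool
⊕Σ {zero}  f = false
⊕Σ {suc k} f = f zero xor ⊕Σ (λ i → f (suc i))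

Vec₂ : ℕ → Set
Vec₂ n = Fin n → Bool

_≐_ : ∀ {n} → Vec₂ n → Vec₂ n → Set
x ≐ y = ∀ i → x i ≡ y i

zeroV : ∀ {n} → Vec₂ n
zeroV _ = false

_·_ : ∀ {n} → (Fin n → Fin n → Bool) → Vec₂ n → Vec₂ n
(M · x) w = ⊕Σ (λ i → M w i ∧ x i)

lincomb : ∀ {n k} → (Fin k → Vec₂ n) → Vec₂ k → Vec₂ n
lincomb b c w = ⊕Σ (λ i → c i ∧ b i w)

LinIndep : ∀ {n k} → (Fin k → Vec₂ n) → Set
LinIndep b = ∀ c → lincomb b c ≐ zeroV → c ≐ zeroV

HasDim : ∀ {n} → (Vec₂ n → Set) → ℕ → Set
HasDim {n} S d =
  Σ (Fin d → Vec₂ n) λ b →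
    (∀ i → S (b i)) × LinIndep b × (∀ v → S v → ∃ λ c → lincomb b c ≐ v)

N : (G : Graph) → Fin (n G) → Fin (n G) → Bool
N G w i = adj G w i ∨ does (w ≟ i)

ColSpace : (G : Graph) → Vec₂ (n G) → Set
ColSpace G v = ∃ λ x → (N G · x) ≐ v

Kernel : (G : Graph) → Vec₂ (n G) → Set
Kernel G x = (N G · x) ≐ zeroV

IsRank : Graph → ℕ → Set
IsRank G d = HasDim (ColSpace G) d

IsNullity : Graph → ℕ → Set
IsNullity G d = HasDim (Kernel G) d

-- Join of two graphs: vertex set Fin (a + b) = disjoint union Fin a ⊎ Fin b

joinAdj : ∀ {a b} → (Fin a → Fin a → Bool) → (Fin b → Fin b → Bool) →
          Fin (a + b) → Fin (a + b) → Bool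
joinAdj {a} A B u v with splitAt a u | splitAt a v
... | inj₁ x | inj₁ y = A x y
... | inj₂ x | inj₂ y = B x y
... | inj₁ _ | inj₂ _ = true
... | inj₂ _ | inj₁ _ = true

joinSym : ∀ {a b} (A : Fin a → Fin a → Bool) (B : Fin b → Fin b → Bool) →
          (∀ u v → A u v ≡ A v u) → (∀ u v → B u v ≡ B v u) →
          ∀ u v → joinAdj A B u v ≡ joinAdj A B v u
joinSym {a} A B sA sB u v with splitAt a u | splitAt a v
... | inj₁ x | inj₁ y = sA x y
... | inj₂ x | inj₂ y = sB x y
... | inj₁ _ | inj₂ _ = refl
... | inj₂ _ | inj₁ _ = refl

joinIrr : ∀ {a b} (A : Fin a → Fin a → Bool) (B : Fin b → Fin b → Bool) →
          (∀ v → A v v ≡ false) → (∀ v → B v v ≡ false) →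
          ∀ v → joinAdj A B v v ≡ false
joinIrr {a} A B iA iB v with splitAt a v
... | inj₁ x = iA x
... | inj₂ x = iB x

_⊕G_ : Graph → Graph → Graph
G ⊕G H = record
  { n      = n G + n H
  ; adj    = joinAdj (adj G) (adj H)
  ; sym    = joinSym (adj G) (adj H) (sym G) (sym H)
  ; irrefl = joinIrr (adj G) (adj H) (irrefl G) (irrefl H)
  }

emptyGraph : Graph
emptyGraph = record { n = 0 ; adj = λ () ; sym = λ () ; irrefl = λ () }

Join : ∀ {m} → (Fin m → Graph) → Graph
Join {zero}  G = emptyGraph
Join {suc m} G = G zero ⊕G Join (λ i → G (suc i))

Σℕ : ∀ {m} → (Fin m → ℕ) → ℕ
Σℕ {zero}  f = 0
Σℕ {suc m} f = f zero + Σℕ (λ i → f (suc i))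

oddCount : ∀ {m} → (Fin m → ℕ) → ℕ
oddCount r = Σℕ (λ i → r i % 2)

-- Over ℤ₂ the quadratic form x ↦ xᵀ N x of a symmetric matrix with unit diagonal is the weight
-- parity Σ xᵢ, so kernel vectors of N(G) have even weight and all solutions of N(G) y = 𝟙 have the
-- same weight parity. Such a solution exists and its parity is ρ(G) mod 2: with X a set of preimages
-- of a basis b of the column space, the Gram matrix A = (Xⱼ ∙ bₖ) is symmetric and invertible, and
-- y = X a with A a = diag A works, of parity dᵀ A⁻¹ d = tr (A A⁻¹) = ρ for d = diag A.
-- For the join, (x₁, x₂) is in the kernel iff N(G) x₁ = |x₂| 𝟙 and N(H) x₂ = |x₁| 𝟙. So the kernel
-- is ker N(G) × ker N(H), enlarged by the single vector (y₁, y₂) exactly when both parities are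
-- odd, and the parity of the join is the disjunction of the two. Induction over G₁ ⊕ ⋯ ⊕ Gₘ then
-- counts one extra dimension for every odd ρ(Gᵢ) but the first.

module Submission where

open import Defs hiding (sym)
open import Data.Nat using (ℕ; zero; suc; _+_; _∸_; _≤_; z≤n; s≤s; _%_)
import Data.Nat.Properties as ℕ
open import Data.Fin using (Fin; zero; suc; punchIn; splitAt; _↑ˡ_; _↑ʳ_; _≟_)
open import Data.Fin.Properties
  using (any?; all?; splitAt-↑ˡ; splitAt-↑ʳ; splitAt⁻¹-↑ˡ; splitAt⁻¹-↑ʳ; ↑ˡ-injective; ↑ʳ-injective)
open import Data.Fin.Subset.Properties using (anySubset?)
open import Data.Bool using (Bool; true; false; _xor_; _∧_; _∨_) renaming (_≟_ to _≟ᴮ_)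
open import Data.Bool.Properties
  using ( not-involutive; ∧-comm; ∧-assoc; ∧-zeroʳ; ∧-identityʳ; ∧-idem; xor-same; xor-identityʳ
        ; ∧-distribˡ-xor; ¬-not; not-¬)
open import Data.Bool.Solver using (module xor-∧-Solver)
open import Data.Product using (_×_; ∃; _,_; proj₁; proj₂)
open import Data.Sum using (_⊎_; inj₁; inj₂)
open import Data.Vec using (lookup; tabulate)
open import Data.Vec.Properties using (lookup∘tabulate)
open import Data.Vec.Functional using (_++_; _∷_; insertAt)
open import Data.Vec.Functional.Properties using (lookup-++ˡ; lookup-++ʳ; insertAt-lookup; insertAt-punchIn)
open import Data.Empty using (⊥-elim)
open import Function using (_∘_)
open import Relation.Nullary using (Dec; yes; no; ¬_; does)
open import Relation.Nullary.Decidable using (dec-true; dec-false)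
open import Relation.Binary.PropositionalEquality
  using (_≡_; _≢_; refl; sym; trans; cong; cong₂; subst; module ≡-Reasoning)

open xor-∧-Solver using (solve; _:=_; _:+_; _:*_)

xor≡false⇒≡ : ∀ a b → a xor b ≡ false → a ≡ b
xor≡false⇒≡ true  true  _ = refl
xor≡false⇒≡ false false _ = refl

_+ᵥ_ : ∀ {n} → Vec₂ n → Vec₂ n → Vec₂ n
(x +ᵥ y) i = x i xor y i

ones : ∀ {n} → Vec₂ n
ones _ = true

unitV : ∀ {n} → Fin n → Vec₂ n
unitV i w = does (w ≟ i)

unitV-sym : ∀ {n} (i j : Fin n) → unitV i j ≡ unitV j i
unitV-sym i j with i ≟ j
... | yes i≡j = dec-true (j ≟ i) (sym i≡j)
... | no  i≢j = dec-false (j ≟ i) (i≢j ∘ sym)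

unitV-diag : ∀ {n} (i : Fin n) → unitV i i ≡ true
unitV-diag i = dec-true (i ≟ i) refl

Mat : ℕ → Set
Mat n = Fin n → Fin n → Bool

diagonal : ∀ {n} → Mat n → Vec₂ n
diagonal M i = M i i

IsSymmetric : ∀ {n} → Mat n → Set
IsSymmetric M = ∀ i j → M i j ≡ M j i

HasUnitDiagonal : ∀ {n} → Mat n → Set
HasUnitDiagonal M = ∀ i → M i i ≡ true

infix 7 _∙_
_∙_ : ∀ {n} → Vec₂ n → Vec₂ n → Bool
u ∙ v = ⊕Σ (λ i → u i ∧ v i)

⊕Σ-cong : ∀ {k} {f g : Vec₂ k} → f ≐ g → ⊕Σ f ≡ ⊕Σ g
⊕Σ-cong {zero}  f≐g = refl
⊕Σ-cong {suc k} f≐g = cong₂ _xor_ (f≐g zero) (⊕Σ-cong (f≐g ∘ suc))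

⊕Σ-zero : ∀ {k} {f : Vec₂ k} → f ≐ zeroV → ⊕Σ f ≡ false
⊕Σ-zero {zero}  f≐0 = refl
⊕Σ-zero {suc k} f≐0 = cong₂ _xor_ (f≐0 zero) (⊕Σ-zero (f≐0 ∘ suc))

⊕Σ-xor : ∀ {k} (f g : Vec₂ k) → ⊕Σ (f +ᵥ g) ≡ ⊕Σ f xor ⊕Σ g
⊕Σ-xor {zero}  f g = refl
⊕Σ-xor {suc k} f g = trans (cong ((f zero xor g zero) xor_) (⊕Σ-xor (f ∘ suc) (g ∘ suc)))
  (solve 4 (λ a b c d → (a :+ b) :+ (c :+ d) := (a :+ c) :+ (b :+ d)) refl (f zero) (g zero) _ _)

⊕Σ-∧ˡ : ∀ {k} b (f : Vec₂ k) → ⊕Σ (λ i → b ∧ f i) ≡ b ∧ ⊕Σ f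
⊕Σ-∧ˡ true  f = refl
⊕Σ-∧ˡ {k} false f = ⊕Σ-zero {k} (λ _ → refl)

⊕Σ-∧ʳ : ∀ {k} b (f : Vec₂ k) → ⊕Σ (λ i → f i ∧ b) ≡ ⊕Σ f ∧ b
⊕Σ-∧ʳ b f = trans (⊕Σ-cong (λ i → ∧-comm (f i) b)) (trans (⊕Σ-∧ˡ b f) (∧-comm b _))

⊕Σ-swap : ∀ {k l} (f : Fin k → Fin l → Bool) →
  ⊕Σ (λ i → ⊕Σ (f i)) ≡ ⊕Σ (λ j → ⊕Σ (λ i → f i j))
⊕Σ-swap {zero} {l} f = sym (⊕Σ-zero {l} (λ _ → refl))
⊕Σ-swap {suc k} f = trans (cong (⊕Σ (f zero) xor_) (⊕Σ-swap (f ∘ suc)))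
                          (sym (⊕Σ-xor (f zero) (λ j → ⊕Σ (λ i → f (suc i) j))))

-- In characteristic 2 the off-diagonal terms of a symmetric double sum cancel in pairs.
⊕Σ-symmetric : ∀ {k} (f : Fin k → Fin k → Bool) → (∀ i j → f i j ≡ f j i) →
  ⊕Σ (λ i → ⊕Σ (f i)) ≡ ⊕Σ (λ i → f i i)
⊕Σ-symmetric {zero}  f f-sym = refl
⊕Σ-symmetric {suc k} f f-sym = begin
    (f zero zero xor ⊕Σ row) xor ⊕Σ (λ i → f (suc i) zero xor ⊕Σ (inner i))
  ≡⟨ cong ((f zero zero xor ⊕Σ row) xor_) (⊕Σ-xor column (λ i → ⊕Σ (inner i))) ⟩
    (f zero zero xor ⊕Σ row) xor (⊕Σ column xor ⊕Σ (λ i → ⊕Σ (inner i)))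
  ≡⟨ cong (λ r → (f zero zero xor r) xor (⊕Σ column xor ⊕Σ (λ i → ⊕Σ (inner i))))
          (⊕Σ-cong (λ j → f-sym zero (suc j))) ⟩
    (f zero zero xor ⊕Σ column) xor (⊕Σ column xor ⊕Σ (λ i → ⊕Σ (inner i)))
  ≡⟨ solve 3 (λ a c r → (a :+ c) :+ (c :+ r) := a :+ r) refl (f zero zero) (⊕Σ column) _ ⟩
    f zero zero xor ⊕Σ (λ i → ⊕Σ (inner i))
  ≡⟨ cong (f zero zero xor_) (⊕Σ-symmetric inner (λ i j → f-sym (suc i) (suc j))) ⟩
    f zero zero xor ⊕Σ (λ i → f (suc i) (suc i))
  ∎
  where
    open ≡-Reasoning
    row column : Vec₂ k
    row j    = f zero (suc j)
    column i = f (suc i) zero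
    inner : Fin k → Fin k → Bool
    inner i j = f (suc i) (suc j)

⊕Σ-punchIn : ∀ {k} (f : Vec₂ (suc k)) p → ⊕Σ f ≡ f p xor ⊕Σ (f ∘ punchIn p)
⊕Σ-punchIn f zero = refl
⊕Σ-punchIn {suc k} f (suc p) =
  trans (cong (f zero xor_) (⊕Σ-punchIn (f ∘ suc) p))
        (solve 3 (λ a b c → a :+ (b :+ c) := b :+ (a :+ c)) refl (f zero) (f (suc p)) _)

⊕Σ-++ : ∀ {p q} (f : Vec₂ (p + q)) → ⊕Σ f ≡ ⊕Σ (f ∘ (_↑ˡ q)) xor ⊕Σ (f ∘ (p ↑ʳ_))
⊕Σ-++ {zero}  f = refl
⊕Σ-++ {suc p} {q} f =
  trans (cong (f zero xor_) (⊕Σ-++ {p} {q} (f ∘ suc)))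
        (solve 3 (λ a b c → a :+ (b :+ c) := (a :+ b) :+ c) refl (f zero) _ _)

↑-elim : ∀ {p q} {P : Fin (p + q) → Set} → (∀ i → P (i ↑ˡ q)) → (∀ j → P (p ↑ʳ j)) → ∀ u → P u
↑-elim {p} {q} {P} Pˡ Pʳ u with splitAt p u in eq
... | inj₁ i = subst P (splitAt⁻¹-↑ˡ eq) (Pˡ i)
... | inj₂ j = subst P (splitAt⁻¹-↑ʳ eq) (Pʳ j)

∙-comm : ∀ {n} (u v : Vec₂ n) → u ∙ v ≡ v ∙ u
∙-comm u v = ⊕Σ-cong (λ i → ∧-comm (u i) (v i))

∙-congʳ : ∀ {n} (u : Vec₂ n) {v v′ : Vec₂ n} → v ≐ v′ → u ∙ v ≡ u ∙ v′
∙-congʳ u v≐v′ = ⊕Σ-cong (λ i → cong (u i ∧_) (v≐v′ i))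

∙-congˡ : ∀ {n} {u u′ : Vec₂ n} (v : Vec₂ n) → u ≐ u′ → u ∙ v ≡ u′ ∙ v
∙-congˡ v u≐u′ = ⊕Σ-cong (λ i → cong (_∧ v i) (u≐u′ i))

∙-zeroʳ : ∀ {n} (u : Vec₂ n) → u ∙ zeroV ≡ false
∙-zeroʳ u = ⊕Σ-zero (λ i → ∧-zeroʳ (u i))

∙-+ᵥ : ∀ {n} (u x y : Vec₂ n) → u ∙ (x +ᵥ y) ≡ u ∙ x xor u ∙ y
∙-+ᵥ u x y = trans (⊕Σ-cong (λ i → ∧-distribˡ-xor (u i) (x i) (y i)))
                   (⊕Σ-xor (λ i → u i ∧ x i) (λ i → u i ∧ y i))

∙-unitV : ∀ {n} (x : Vec₂ n) i → x ∙ unitV i ≡ x i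
∙-unitV {suc n} x zero = trans (cong₂ _xor_ (∧-identityʳ (x zero)) (⊕Σ-zero (λ j → ∧-zeroʳ (x (suc j)))))
                               (xor-identityʳ (x zero))
∙-unitV {suc n} x (suc i) = trans (cong (_xor (x ∘ suc) ∙ unitV i) (∧-zeroʳ (x zero))) (∙-unitV (x ∘ suc) i)

∙-lincomb : ∀ {n d} (u : Vec₂ n) (b : Fin d → Vec₂ n) (c : Vec₂ d) →
  u ∙ lincomb b c ≡ ⊕Σ (λ j → c j ∧ u ∙ b j)
∙-lincomb u b c = begin
    ⊕Σ (λ w → u w ∧ ⊕Σ (λ j → c j ∧ b j w))
  ≡⟨ ⊕Σ-cong (λ w → sym (⊕Σ-∧ˡ (u w) (λ j → c j ∧ b j w))) ⟩
    ⊕Σ (λ w → ⊕Σ (λ j → u w ∧ (c j ∧ b j w)))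
  ≡⟨ ⊕Σ-swap (λ w j → u w ∧ (c j ∧ b j w)) ⟩
    ⊕Σ (λ j → ⊕Σ (λ w → u w ∧ (c j ∧ b j w)))
  ≡⟨ ⊕Σ-cong (λ j → trans (⊕Σ-cong (λ w →
                            solve 3 (λ x y z → x :* (y :* z) := y :* (x :* z)) refl (u w) (c j) (b j w)))
                          (⊕Σ-∧ˡ (c j) (λ w → u w ∧ b j w))) ⟩
    ⊕Σ (λ j → c j ∧ u ∙ b j)
  ∎ where open ≡-Reasoning

lincomb-congˡ : ∀ {n d} {b b′ : Fin d → Vec₂ n} (c : Vec₂ d) →
  (∀ j → b j ≐ b′ j) → lincomb b c ≐ lincomb b′ c
lincomb-congˡ c b≐b′ w = ⊕Σ-cong (λ j → cong (c j ∧_) (b≐b′ j w))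

lincomb-congʳ : ∀ {n d} (b : Fin d → Vec₂ n) {c c′ : Vec₂ d} → c ≐ c′ → lincomb b c ≐ lincomb b c′
lincomb-congʳ b c≐c′ w = ⊕Σ-cong (λ j → cong (_∧ b j w) (c≐c′ j))

lincomb-unitV : ∀ {n} (c : Vec₂ n) → lincomb unitV c ≐ c
lincomb-unitV c i = trans (⊕Σ-cong (λ k → cong (c k ∧_) (unitV-sym k i))) (∙-unitV c i)

·-cong : ∀ {n} (M : Mat n) {x y : Vec₂ n} → x ≐ y → (M · x) ≐ (M · y)
·-cong M x≐y w = ∙-congʳ (M w) x≐y

·-zero : ∀ {n} (M : Mat n) → (M · zeroV) ≐ zeroV
·-zero M w = ∙-zeroʳ (M w)

·-+ᵥ : ∀ {n} (M : Mat n) (x y : Vec₂ n) → (M · (x +ᵥ y)) ≐ ((M · x) +ᵥ (M · y))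
·-+ᵥ M x y w = ∙-+ᵥ (M w) x y

·-lincomb : ∀ {n d} (M : Mat n) (x : Fin d → Vec₂ n) (c : Vec₂ d) →
  (M · lincomb x c) ≐ lincomb (λ j → M · x j) c
·-lincomb M x c w = ∙-lincomb (M w) x c

·-unitV : ∀ {n} (M : Mat n) i w → (M · unitV i) w ≡ M w i
·-unitV M i w = ∙-unitV (M w) i

ones-solution-difference : ∀ {n} (M : Mat n) {x y : Vec₂ n} →
  (M · x) ≐ ones → (M · y) ≐ ones → (M · (x +ᵥ y)) ≐ zeroV
ones-solution-difference M {x} {y} Mx≐ones My≐ones w = trans (·-+ᵥ M x y w) (cong₂ _xor_ (Mx≐ones w) (My≐ones w))

∙-·-symmetric : ∀ {n} (M : Mat n) → IsSymmetric M → (u z : Vec₂ n) → u ∙ (M · z) ≡ (M · u) ∙ z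
∙-·-symmetric M M-sym u z = begin
    ⊕Σ (λ w → u w ∧ ⊕Σ (λ i → M w i ∧ z i))
  ≡⟨ ⊕Σ-cong (λ w → sym (⊕Σ-∧ˡ (u w) (λ i → M w i ∧ z i))) ⟩
    ⊕Σ (λ w → ⊕Σ (λ i → u w ∧ (M w i ∧ z i)))
  ≡⟨ ⊕Σ-swap (λ w i → u w ∧ (M w i ∧ z i)) ⟩
    ⊕Σ (λ i → ⊕Σ (λ w → u w ∧ (M w i ∧ z i)))
  ≡⟨ ⊕Σ-cong (λ i → trans (⊕Σ-cong (λ w → trans (cong (λ m → u w ∧ (m ∧ z i)) (M-sym w i))
                                                  (solve 3 (λ x m y → x :* (m :* y) := (m :* x) :* y) refl
                                                         (u w) (M i w) (z i))))
                          (⊕Σ-∧ʳ (z i) (λ w → M i w ∧ u w))) ⟩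
    ⊕Σ (λ i → ⊕Σ (λ w → M i w ∧ u w) ∧ z i)
  ∎ where open ≡-Reasoning

quadratic-form : ∀ {n} (M : Mat n) → IsSymmetric M → (x : Vec₂ n) → x ∙ (M · x) ≡ x ∙ diagonal M
quadratic-form M M-sym x = begin
    ⊕Σ (λ w → x w ∧ ⊕Σ (λ i → M w i ∧ x i))
  ≡⟨ ⊕Σ-cong (λ w → sym (⊕Σ-∧ˡ (x w) (λ i → M w i ∧ x i))) ⟩
    ⊕Σ (λ w → ⊕Σ (λ i → x w ∧ (M w i ∧ x i)))
  ≡⟨ ⊕Σ-symmetric (λ w i → x w ∧ (M w i ∧ x i))
       (λ w i → trans (cong (λ m → x w ∧ (m ∧ x i)) (M-sym w i))
                      (solve 3 (λ a m b → a :* (m :* b) := b :* (m :* a)) refl (x w) (M i w) (x i))) ⟩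
    ⊕Σ (λ w → x w ∧ (M w w ∧ x w))
  ≡⟨ ⊕Σ-cong (λ w → trans (solve 2 (λ a m → a :* (m :* a) := (a :* a) :* m) refl (x w) (M w w))
                          (cong (_∧ M w w) (∧-idem (x w)))) ⟩
    x ∙ diagonal M
  ∎ where open ≡-Reasoning

quadratic-form-unitDiagonal : ∀ {n} (M : Mat n) → IsSymmetric M → HasUnitDiagonal M →
  (x : Vec₂ n) → x ∙ (M · x) ≡ ⊕Σ x
quadratic-form-unitDiagonal M M-sym M-diag x =
  trans (quadratic-form M M-sym x) (⊕Σ-cong (λ w → trans (cong (x w ∧_) (M-diag w)) (∧-identityʳ (x w))))

kernel-even : ∀ {n} (M : Mat n) → IsSymmetric M → HasUnitDiagonal M →
  ∀ x → (M · x) ≐ zeroV → ⊕Σ x ≡ false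
kernel-even M M-sym M-diag x Mx≐0 =
  trans (sym (quadratic-form-unitDiagonal M M-sym M-diag x)) (trans (∙-congʳ x Mx≐0) (∙-zeroʳ x))

lincomb-insertAt : ∀ {n k} (A : Fin (suc k) → Vec₂ n) p t (c : Vec₂ k) w →
  lincomb A (insertAt c p t) w ≡ (t ∧ A p w) xor lincomb (A ∘ punchIn p) c w
lincomb-insertAt A p t c w = begin
    ⊕Σ (λ i → insertAt c p t i ∧ A i w)
  ≡⟨ ⊕Σ-punchIn (λ i → insertAt c p t i ∧ A i w) p ⟩
    (insertAt c p t p ∧ A p w) xor ⊕Σ (λ i → insertAt c p t (punchIn p i) ∧ A (punchIn p i) w)
  ≡⟨ cong₂ (λ s f → (s ∧ A p w) xor f) (insertAt-lookup c p t)
           (⊕Σ-cong (λ i → cong (_∧ A (punchIn p i) w) (insertAt-punchIn c p t i))) ⟩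
    (t ∧ A p w) xor lincomb (A ∘ punchIn p) c w
  ∎ where open ≡-Reasoning

-- One step of Gaussian elimination on the first coordinate, against the pivot A p.
eliminate : ∀ {n k} → (Fin (suc k) → Vec₂ (suc n)) → Fin (suc k) → Fin k → Vec₂ n
eliminate A p i j = A (punchIn p i) (suc j) xor (A (punchIn p i) zero ∧ A p (suc j))

lincomb-eliminate : ∀ {n k} (A : Fin (suc k) → Vec₂ (suc n)) p (c : Vec₂ k) j →
  lincomb (eliminate A p) c j ≡
  lincomb (A ∘ punchIn p) c (suc j) xor (lincomb (A ∘ punchIn p) c zero ∧ A p (suc j))
lincomb-eliminate A p c j = begin
    ⊕Σ (λ i → c i ∧ (B i (suc j) xor (B i zero ∧ A p (suc j))))
  ≡⟨ ⊕Σ-cong (λ i → solve 4 (λ x y z a → x :* (y :+ (z :* a)) := (x :* y) :+ ((x :* z) :* a)) refl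
                            (c i) (B i (suc j)) (B i zero) (A p (suc j))) ⟩
    ⊕Σ (λ i → (c i ∧ B i (suc j)) xor ((c i ∧ B i zero) ∧ A p (suc j)))
  ≡⟨ ⊕Σ-xor (λ i → c i ∧ B i (suc j)) (λ i → (c i ∧ B i zero) ∧ A p (suc j)) ⟩
    lincomb B c (suc j) xor ⊕Σ (λ i → (c i ∧ B i zero) ∧ A p (suc j))
  ≡⟨ cong (lincomb B c (suc j) xor_) (⊕Σ-∧ʳ (A p (suc j)) (λ i → c i ∧ B i zero)) ⟩
    lincomb B c (suc j) xor (lincomb B c zero ∧ A p (suc j))
  ∎
  where
    open ≡-Reasoning
    B = A ∘ punchIn p

LinIndep-eliminate : ∀ {n k} (A : Fin (suc k) → Vec₂ (suc n)) p → A p zero ≡ true →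
  LinIndep A → LinIndep (eliminate A p)
LinIndep-eliminate A p pivot A-indep c elim≐0 i =
  trans (sym (insertAt-punchIn c p t i)) (A-indep (insertAt c p t) combination≐0 (punchIn p i))
  where
    B = A ∘ punchIn p
    t = lincomb B c zero
    combination≐0 : lincomb A (insertAt c p t) ≐ zeroV
    combination≐0 zero = begin
        lincomb A (insertAt c p t) zero
      ≡⟨ lincomb-insertAt A p t c zero ⟩
        (t ∧ A p zero) xor t
      ≡⟨ cong (λ a → (t ∧ a) xor t) pivot ⟩
        (t ∧ true) xor t
      ≡⟨ cong (_xor t) (∧-identityʳ t) ⟩
        t xor t
      ≡⟨ xor-same t ⟩
        false
      ∎ where open ≡-Reasoning
    combination≐0 (suc j) = begin
        lincomb A (insertAt c p t) (suc j)
      ≡⟨ lincomb-insertAt A p t c (suc j) ⟩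
        (t ∧ A p (suc j)) xor lincomb B c (suc j)
      ≡⟨ solve 2 (λ x y → x :+ y := y :+ x) refl (t ∧ A p (suc j)) (lincomb B c (suc j)) ⟩
        lincomb B c (suc j) xor (t ∧ A p (suc j))
      ≡⟨ sym (lincomb-eliminate A p c j) ⟩
        lincomb (eliminate A p) c j
      ≡⟨ elim≐0 j ⟩
        false
      ∎ where open ≡-Reasoning

LinIndep-tail : ∀ {n k} (A : Fin k → Vec₂ (suc n)) → (∀ i → A i zero ≡ false) →
  LinIndep A → LinIndep (λ i → A i ∘ suc)
LinIndep-tail A A₀≡0 A-indep c tail≐0 = A-indep c λ
  { zero    → ⊕Σ-zero (λ i → trans (cong (c i ∧_) (A₀≡0 i)) (∧-zeroʳ (c i)))
  ; (suc j) → tail≐0 j }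

LinIndep⇒≤ : ∀ {n k} (A : Fin k → Vec₂ n) → LinIndep A → k ≤ n
LinIndep⇒≤ {k = zero} A A-indep = z≤n
LinIndep⇒≤ {zero} {suc k} A A-indep with A-indep ones (λ ()) zero
... | ()
LinIndep⇒≤ {suc n} {suc k} A A-indep with any? (λ i → A i zero ≟ᴮ true)
... | yes (p , pivot) = s≤s (LinIndep⇒≤ (eliminate A p) (LinIndep-eliminate A p pivot A-indep))
... | no no-pivot = ℕ.m≤n⇒m≤1+n (LinIndep⇒≤ (λ i → A i ∘ suc)
                       (LinIndep-tail A (λ i → ¬-not (λ A₀≡1 → no-pivot (i , A₀≡1))) A-indep))

lincomb-lincomb : ∀ {n d d′} (b : Fin d → Vec₂ n) (b′ : Fin d′ → Vec₂ n) (C : Fin d → Vec₂ d′) →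
  (∀ i → lincomb b′ (C i) ≐ b i) → ∀ c → lincomb b c ≐ lincomb b′ (lincomb C c)
lincomb-lincomb b b′ C b≐b′C c w = begin
    ⊕Σ (λ i → c i ∧ b i w)
  ≡⟨ ⊕Σ-cong (λ i → cong (c i ∧_) (sym (b≐b′C i w))) ⟩
    ⊕Σ (λ i → c i ∧ ⊕Σ (λ j → C i j ∧ b′ j w))
  ≡⟨ ⊕Σ-cong (λ i → sym (⊕Σ-∧ˡ (c i) (λ j → C i j ∧ b′ j w))) ⟩
    ⊕Σ (λ i → ⊕Σ (λ j → c i ∧ (C i j ∧ b′ j w)))
  ≡⟨ ⊕Σ-swap (λ i j → c i ∧ (C i j ∧ b′ j w)) ⟩
    ⊕Σ (λ j → ⊕Σ (λ i → c i ∧ (C i j ∧ b′ j w)))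
  ≡⟨ ⊕Σ-cong (λ j → trans (⊕Σ-cong (λ i → sym (∧-assoc (c i) (C i j) (b′ j w))))
                          (⊕Σ-∧ʳ (b′ j w) (λ i → c i ∧ C i j))) ⟩
    ⊕Σ (λ j → ⊕Σ (λ i → c i ∧ C i j) ∧ b′ j w)
  ∎ where open ≡-Reasoning

HasDim-≤ : ∀ {n} {S : Vec₂ n → Set} {d d′} → HasDim S d → HasDim S d′ → d ≤ d′
HasDim-≤ {d = d} {d′} (b , b∈S , b-indep , _) (b′ , _ , _ , b′-spans) = LinIndep⇒≤ C C-indep
  where
    C : Fin d → Vec₂ d′
    C i = proj₁ (b′-spans (b i) (b∈S i))
    C-indep : LinIndep C
    C-indep c Cc≐0 = b-indep c λ w →
      trans (lincomb-lincomb b b′ C (λ i → proj₂ (b′-spans (b i) (b∈S i))) c w)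
            (⊕Σ-zero (λ j → cong (_∧ b′ j w) (Cc≐0 j)))

HasDim-unique : ∀ {n} {S : Vec₂ n → Set} {d d′} → HasDim S d → HasDim S d′ → d ≡ d′
HasDim-unique dim dim′ = ℕ.≤-antisym (HasDim-≤ dim dim′) (HasDim-≤ dim′ dim)

Respects≐ : ∀ {n} → (Vec₂ n → Set) → Set
Respects≐ S = ∀ {x y} → x ≐ y → S x → S y

HasDim-⇔ : ∀ {n} {S T : Vec₂ n → Set} {d} →
  (∀ x → T x → S x) → (∀ x → S x → T x) → HasDim S d → HasDim T d
HasDim-⇔ T⊆S S⊆T (b , b∈S , b-indep , b-spans) =
  b , (λ i → S⊆T _ (b∈S i)) , b-indep , (λ v v∈T → b-spans v (T⊆S v v∈T))

HasDim-suc : ∀ {n} {S T : Vec₂ n → Set} {d} (u v : Vec₂ n) → HasDim S d → (∀ x → S x → T x) → T v →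
  (∀ x → S x → u ∙ x ≡ false) → u ∙ v ≡ true → (∀ x → T x → S x ⊎ S (x +ᵥ v)) → HasDim T (suc d)
HasDim-suc {n} {S} {T} {d} u v (b , b∈S , b-indep , b-spans) S⊆T v∈T u⊥S u∙v≡1 T⊆S∪S+v =
  v ∷ b , (λ { zero → v∈T ; (suc i) → S⊆T _ (b∈S i) }) , v∷b-indep , v∷b-spans
  where
    v∷b-indep : LinIndep (v ∷ b)
    v∷b-indep c comb≐0 = λ { zero → c₀≡0 ; (suc i) → tail≡0 i }
      where
        open ≡-Reasoning
        c₀≡0 : c zero ≡ false
        c₀≡0 = sym (begin
            false
          ≡⟨ sym (trans (∙-congʳ u comb≐0) (∙-zeroʳ u)) ⟩
            u ∙ lincomb (v ∷ b) c
          ≡⟨ ∙-lincomb u (v ∷ b) c ⟩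
            (c zero ∧ u ∙ v) xor ⊕Σ (λ i → c (suc i) ∧ u ∙ b i)
          ≡⟨ cong₂ (λ t r → (c zero ∧ t) xor r) u∙v≡1
                   (⊕Σ-zero (λ i → trans (cong (c (suc i) ∧_) (u⊥S _ (b∈S i))) (∧-zeroʳ _))) ⟩
            (c zero ∧ true) xor false
          ≡⟨ trans (xor-identityʳ _) (∧-identityʳ (c zero)) ⟩
            c zero
          ∎)
        tail≡0 : (c ∘ suc) ≐ zeroV
        tail≡0 = b-indep (c ∘ suc) λ w →
          trans (cong (λ t → (t ∧ v w) xor lincomb b (c ∘ suc) w) (sym c₀≡0)) (comb≐0 w)
    v∷b-spans : ∀ x → T x → ∃ λ c → lincomb (v ∷ b) c ≐ x
    v∷b-spans x x∈T with T⊆S∪S+v x x∈T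
    ... | inj₁ x∈S   = let (c , bc≐x) = b-spans x x∈S in false ∷ c , bc≐x
    ... | inj₂ x+v∈S = let (c , bc≐x+v) = b-spans (x +ᵥ v) x+v∈S in true ∷ c ,
          λ w → trans (cong (v w xor_) (bc≐x+v w)) (solve 2 (λ a b → a :+ (b :+ a) := b) refl (v w) (x w))

module _ {p q d₁ d₂} (b₁ : Fin d₁ → Vec₂ p) (b₂ : Fin d₂ → Vec₂ q) where

  private
    B₁ : Fin d₁ → Vec₂ (p + q)
    B₁ j = b₁ j ++ zeroV

    B₂ : Fin d₂ → Vec₂ (p + q)
    B₂ j = zeroV ++ b₂ j

  blockBasis : Fin (d₁ + d₂) → Vec₂ (p + q)
  blockBasis = B₁ ++ B₂

  blockBasis-ˡˡ : ∀ j i → blockBasis (j ↑ˡ d₂) (i ↑ˡ q) ≡ b₁ j i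
  blockBasis-ˡˡ j i = trans (cong (λ v → v (i ↑ˡ q)) (lookup-++ˡ B₁ B₂ j))
                            (lookup-++ˡ (b₁ j) zeroV i)

  blockBasis-ˡʳ : ∀ j i → blockBasis (j ↑ˡ d₂) (p ↑ʳ i) ≡ false
  blockBasis-ˡʳ j i = trans (cong (λ v → v (p ↑ʳ i)) (lookup-++ˡ B₁ B₂ j))
                            (lookup-++ʳ {m = p} (b₁ j) zeroV i)

  blockBasis-ʳˡ : ∀ j i → blockBasis (d₁ ↑ʳ j) (i ↑ˡ q) ≡ false
  blockBasis-ʳˡ j i = trans (cong (λ v → v (i ↑ˡ q)) (lookup-++ʳ B₁ B₂ j))
                            (lookup-++ˡ zeroV (b₂ j) i)

  blockBasis-ʳʳ : ∀ j i → blockBasis (d₁ ↑ʳ j) (p ↑ʳ i) ≡ b₂ j i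
  blockBasis-ʳʳ j i = trans (cong (λ v → v (p ↑ʳ i)) (lookup-++ʳ B₁ B₂ j))
                            (lookup-++ʳ {m = p} zeroV (b₂ j) i)

  lincomb-blockBasis-ˡ : ∀ c i → lincomb blockBasis c (i ↑ˡ q) ≡ lincomb b₁ (c ∘ (_↑ˡ d₂)) i
  lincomb-blockBasis-ˡ c i = trans (⊕Σ-++ {d₁} {d₂} (λ k → c k ∧ blockBasis k (i ↑ˡ q)))
    (trans (cong₂ _xor_ (⊕Σ-cong (λ j → cong (c (j ↑ˡ d₂) ∧_) (blockBasis-ˡˡ j i)))
                        (⊕Σ-zero (λ j → trans (cong (c (d₁ ↑ʳ j) ∧_) (blockBasis-ʳˡ j i)) (∧-zeroʳ _))))
           (xor-identityʳ _))

  lincomb-blockBasis-ʳ : ∀ c i → lincomb blockBasis c (p ↑ʳ i) ≡ lincomb b₂ (c ∘ (d₁ ↑ʳ_)) i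
  lincomb-blockBasis-ʳ c i = trans (⊕Σ-++ {d₁} {d₂} (λ k → c k ∧ blockBasis k (p ↑ʳ i)))
    (cong₂ _xor_ (⊕Σ-zero (λ j → trans (cong (c (j ↑ˡ d₂) ∧_) (blockBasis-ˡʳ j i)) (∧-zeroʳ _)))
                 (⊕Σ-cong (λ j → cong (c (d₁ ↑ʳ j) ∧_) (blockBasis-ʳʳ j i))))

HasDim-× : ∀ {p q} {S₁ : Vec₂ p → Set} {S₂ : Vec₂ q → Set} {d₁ d₂} →
  Respects≐ S₁ → Respects≐ S₂ → S₁ zeroV → S₂ zeroV → HasDim S₁ d₁ → HasDim S₂ d₂ →
  HasDim (λ x → S₁ (x ∘ (_↑ˡ q)) × S₂ (x ∘ (p ↑ʳ_))) (d₁ + d₂)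
HasDim-× {p} {q} {S₁} {S₂} {d₁} {d₂} S₁-resp S₂-resp 0∈S₁ 0∈S₂
         (b₁ , b₁∈S₁ , b₁-indep , b₁-spans) (b₂ , b₂∈S₂ , b₂-indep , b₂-spans) =
  B , B∈S , B-indep , B-spans
  where
    B = blockBasis b₁ b₂

    B∈S : ∀ k → S₁ (B k ∘ (_↑ˡ q)) × S₂ (B k ∘ (p ↑ʳ_))
    B∈S = ↑-elim
      (λ j → S₁-resp (sym ∘ blockBasis-ˡˡ b₁ b₂ j) (b₁∈S₁ j) , S₂-resp (sym ∘ blockBasis-ˡʳ b₁ b₂ j) 0∈S₂)
      (λ j → S₁-resp (sym ∘ blockBasis-ʳˡ b₁ b₂ j) 0∈S₁ , S₂-resp (sym ∘ blockBasis-ʳʳ b₁ b₂ j) (b₂∈S₂ j))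

    B-indep : LinIndep B
    B-indep c Bc≐0 = ↑-elim
      (b₁-indep (c ∘ (_↑ˡ d₂)) (λ i → trans (sym (lincomb-blockBasis-ˡ b₁ b₂ c i)) (Bc≐0 (i ↑ˡ q))))
      (b₂-indep (c ∘ (d₁ ↑ʳ_)) (λ i → trans (sym (lincomb-blockBasis-ʳ b₁ b₂ c i)) (Bc≐0 (p ↑ʳ i))))

    B-spans : ∀ x → S₁ (x ∘ (_↑ˡ q)) × S₂ (x ∘ (p ↑ʳ_)) → ∃ λ c → lincomb B c ≐ x
    B-spans x (x₁∈S₁ , x₂∈S₂) = c₁ ++ c₂ , ↑-elim
        (λ i → trans (lincomb-blockBasis-ˡ b₁ b₂ (c₁ ++ c₂) i)
                     (trans (lincomb-congʳ b₁ (lookup-++ˡ c₁ c₂) i) (b₁c₁≐x₁ i)))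
        (λ i → trans (lincomb-blockBasis-ʳ b₁ b₂ (c₁ ++ c₂) i)
                     (trans (lincomb-congʳ b₂ (lookup-++ʳ c₁ c₂) i) (b₂c₂≐x₂ i)))
      where
        c₁ = proj₁ (b₁-spans _ x₁∈S₁)
        b₁c₁≐x₁ = proj₂ (b₁-spans _ x₁∈S₁)
        c₂ = proj₁ (b₂-spans _ x₂∈S₂)
        b₂c₂≐x₂ = proj₂ (b₂-spans _ x₂∈S₂)

TrivialKernel : ∀ {n} → Mat n → Set
TrivialKernel A = ∀ a → (A · a) ≐ zeroV → a ≐ zeroV

·-solvable? : ∀ {n} (A : Mat n) (d : Vec₂ n) → Dec (∃ λ a → (A · a) ≐ d)
·-solvable? A d with anySubset? (λ s → all? (λ i → (A · lookup s) i ≟ᴮ d i))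
... | yes (s , As≐d) = yes (lookup s , As≐d)
... | no ¬sol = no λ (a , Aa≐d) →
  ¬sol (tabulate a , λ i → trans (·-cong A (lookup∘tabulate a) i) (Aa≐d i))

-- Otherwise d together with the n columns of A would be n + 1 independent vectors in ℤ₂ⁿ.
TrivialKernel⇒surjective : ∀ {n} (A : Mat n) → TrivialKernel A → ∀ d → ∃ λ a → (A · a) ≐ d
TrivialKernel⇒surjective {n} A A-inj d with ·-solvable? A d
... | yes sol = sol
... | no ¬sol = ⊥-elim (ℕ.<-irrefl refl (LinIndep⇒≤ (d ∷ column) d∷column-indep))
  where
    column : Fin n → Vec₂ n
    column k j = A j k
    columns-comb : ∀ (c : Vec₂ n) j → ⊕Σ (λ k → c k ∧ column k j) ≡ (A · c) j
    columns-comb c j = ⊕Σ-cong (λ k → ∧-comm (c k) (A j k))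
    d∷column-indep : LinIndep (d ∷ column)
    d∷column-indep c comb≐0 with c zero in c₀
    ... | true  = ⊥-elim (¬sol (c ∘ suc , λ j →
                    sym (trans (xor≡false⇒≡ (d j) _ (comb≐0 j)) (columns-comb (c ∘ suc) j))))
    ... | false = λ { zero → c₀
                    ; (suc k) → A-inj (c ∘ suc) (λ j → trans (sym (columns-comb (c ∘ suc) j)) (comb≐0 j)) k }

module _ {k} (A : Mat k) (A-sym : IsSymmetric A) (A-inj : TrivialKernel A) where

  private
    W : Fin k → Vec₂ k
    W j = proj₁ (TrivialKernel⇒surjective A A-inj (unitV j))

    AW≐unitV : ∀ j → (A · W j) ≐ unitV j
    AW≐unitV j = proj₂ (TrivialKernel⇒surjective A A-inj (unitV j))

    W-sym : ∀ i j → W i j ≡ W j i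
    W-sym i j = begin
        W i j
      ≡⟨ sym (∙-unitV (W i) j) ⟩
        W i ∙ unitV j
      ≡⟨ ∙-congʳ (W i) (λ l → sym (AW≐unitV j l)) ⟩
        W i ∙ (A · W j)
      ≡⟨ ∙-·-symmetric A A-sym (W i) (W j) ⟩
        (A · W i) ∙ W j
      ≡⟨ ∙-congˡ (W j) (AW≐unitV i) ⟩
        unitV i ∙ W j
      ≡⟨ ∙-comm (unitV i) (W j) ⟩
        W j ∙ unitV i
      ≡⟨ ∙-unitV (W j) i ⟩
        W j i
      ∎ where open ≡-Reasoning

    solution≐W : ∀ {a d} → (A · a) ≐ d → a ≐ lincomb W d
    solution≐W {a} {d} Aa≐d j = xor≡false⇒≡ _ _ (A-inj (a +ᵥ lincomb W d) A[a+Wd]≐0 j)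
      where
        A[a+Wd]≐0 : (A · (a +ᵥ lincomb W d)) ≐ zeroV
        A[a+Wd]≐0 i = begin
            (A · (a +ᵥ lincomb W d)) i
          ≡⟨ ·-+ᵥ A a (lincomb W d) i ⟩
            (A · a) i xor (A · lincomb W d) i
          ≡⟨ cong₂ _xor_ (Aa≐d i) (trans (·-lincomb A W d i) (lincomb-congˡ d AW≐unitV i)) ⟩
            d i xor lincomb unitV d i
          ≡⟨ cong (d i xor_) (lincomb-unitV d i) ⟩
            d i xor d i
          ≡⟨ xor-same (d i) ⟩
            false
          ∎ where open ≡-Reasoning

  -- Both sides equal Σⱼ Aⱼⱼ Wⱼⱼ for W = A⁻¹: the left side is dᵀ W d, the right side is tr (A W).
  diagonal-solution-parity : ∀ a → (A · a) ≐ diagonal A → a ∙ diagonal A ≡ ⊕Σ {k} ones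
  diagonal-solution-parity a Aa≐d = trans dWd (sym trAW)
    where
      open ≡-Reasoning
      d = diagonal A
      dWd : a ∙ d ≡ ⊕Σ (λ j → A j j ∧ W j j)
      dWd = begin
          ⊕Σ (λ j → a j ∧ d j)
        ≡⟨ ⊕Σ-cong (λ j → trans (cong (_∧ d j) (solution≐W Aa≐d j))
                                (sym (⊕Σ-∧ʳ (d j) (λ i → d i ∧ W i j)))) ⟩
          ⊕Σ (λ j → ⊕Σ (λ i → (d i ∧ W i j) ∧ d j))
        ≡⟨ ⊕Σ-symmetric (λ j i → (d i ∧ W i j) ∧ d j)
             (λ j i → trans (cong (λ w → (d i ∧ w) ∧ d j) (W-sym i j))
                            (solve 3 (λ x w y → (x :* w) :* y := (y :* w) :* x) refl (d i) (W j i) (d j))) ⟩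
          ⊕Σ (λ j → (d j ∧ W j j) ∧ d j)
        ≡⟨ ⊕Σ-cong (λ j → trans (solve 2 (λ x w → (x :* w) :* x := (x :* x) :* w) refl (d j) (W j j))
                                (cong (_∧ W j j) (∧-idem (d j)))) ⟩
          ⊕Σ (λ j → A j j ∧ W j j)
        ∎
      trAW : ⊕Σ {k} ones ≡ ⊕Σ (λ j → A j j ∧ W j j)
      trAW = begin
          ⊕Σ {k} ones
        ≡⟨ ⊕Σ-cong (λ j → sym (trans (AW≐unitV j j) (unitV-diag j))) ⟩
          ⊕Σ (λ j → ⊕Σ (λ i → A j i ∧ W j i))
        ≡⟨ ⊕Σ-symmetric (λ j i → A j i ∧ W j i) (λ j i → cong₂ _∧_ (A-sym j i) (W-sym j i)) ⟩
          ⊕Σ (λ j → A j j ∧ W j j)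
        ∎

Col : ∀ {n} → Mat n → Vec₂ n → Set
Col M v = ∃ λ x → (M · x) ≐ v

OnesSolution : ∀ {n} → Mat n → Bool → Set
OnesSolution M s = ∃ λ y → (M · y) ≐ ones × ⊕Σ y ≡ s

OnesSolution-parity : ∀ {n s} (M : Mat n) → IsSymmetric M → HasUnitDiagonal M →
  OnesSolution M s → ∀ x → (M · x) ≐ ones → ⊕Σ x ≡ s
OnesSolution-parity M M-sym M-diag (y , My≐ones , ⊕Σy≡s) x Mx≐ones =
  trans (xor≡false⇒≡ _ _ (trans (sym (⊕Σ-xor x y))
    (kernel-even M M-sym M-diag (x +ᵥ y) (ones-solution-difference M Mx≐ones My≐ones)))) ⊕Σy≡s

module _ {n ρ} (M : Mat n) (M-sym : IsSymmetric M) (M-diag : HasUnitDiagonal M) (rank : HasDim (Col M) ρ) where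

  private
    b : Fin ρ → Vec₂ n
    b = proj₁ rank

    b∈Col : ∀ j → Col M (b j)
    b∈Col = proj₁ (proj₂ rank)

    b-indep : LinIndep b
    b-indep = proj₁ (proj₂ (proj₂ rank))

    b-spans : ∀ v → Col M v → ∃ λ c → lincomb b c ≐ v
    b-spans = proj₂ (proj₂ (proj₂ rank))

    X : Fin ρ → Vec₂ n
    X j = proj₁ (b∈Col j)

    MX≐b : ∀ j → (M · X j) ≐ b j
    MX≐b j = proj₂ (b∈Col j)

    coords : Fin n → Vec₂ ρ
    coords i = proj₁ (b-spans (λ w → M w i) (unitV i , ·-unitV M i))

    b-coords≐row : ∀ i → lincomb b (coords i) ≐ M i
    b-coords≐row i w = trans (proj₂ (b-spans (λ w → M w i) (unitV i , ·-unitV M i)) w) (M-sym w i)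

    gram : Mat ρ
    gram j k = X j ∙ b k

    X∙M· : ∀ j z → X j ∙ (M · z) ≡ b j ∙ z
    X∙M· j z = trans (∙-·-symmetric M M-sym (X j) z) (∙-congˡ z (MX≐b j))

    gram-sym : IsSymmetric gram
    gram-sym j k = begin
        X j ∙ b k
      ≡⟨ ∙-congʳ (X j) (λ w → sym (MX≐b k w)) ⟩
        X j ∙ (M · X k)
      ≡⟨ X∙M· j (X k) ⟩
        b j ∙ X k
      ≡⟨ ∙-comm (b j) (X k) ⟩
        X k ∙ b j
      ∎ where open ≡-Reasoning

    M·X : ∀ a → (M · lincomb X a) ≐ lincomb b a
    M·X a w = trans (·-lincomb M X a w) (lincomb-congˡ a MX≐b w)

    gram· : ∀ a j → (gram · a) j ≡ X j ∙ (M · lincomb X a)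
    gram· a j = begin
        ⊕Σ (λ k → (X j ∙ b k) ∧ a k)
      ≡⟨ ⊕Σ-cong (λ k → ∧-comm (X j ∙ b k) (a k)) ⟩
        ⊕Σ (λ k → a k ∧ X j ∙ b k)
      ≡⟨ sym (∙-lincomb (X j) b a) ⟩
        X j ∙ lincomb b a
      ≡⟨ sym (∙-congʳ (X j) (M·X a)) ⟩
        X j ∙ (M · lincomb X a)
      ∎ where open ≡-Reasoning

    -- M z is determined by the numbers X j ∙ M z, since every row of M lies in the span of b.
    M·-via-gram : ∀ z i → (M · z) i ≡ coords i ∙ (λ j → X j ∙ (M · z))
    M·-via-gram z i = begin
        M i ∙ z
      ≡⟨ ∙-congˡ z (λ w → sym (b-coords≐row i w)) ⟩
        lincomb b (coords i) ∙ z
      ≡⟨ ∙-comm (lincomb b (coords i)) z ⟩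
        z ∙ lincomb b (coords i)
      ≡⟨ ∙-lincomb z b (coords i) ⟩
        ⊕Σ (λ j → coords i j ∧ z ∙ b j)
      ≡⟨ ⊕Σ-cong (λ j → cong (coords i j ∧_) (trans (∙-comm z (b j)) (sym (X∙M· j z)))) ⟩
        coords i ∙ (λ j → X j ∙ (M · z))
      ∎ where open ≡-Reasoning

    gram-inj : TrivialKernel gram
    gram-inj a gram·a≐0 = b-indep a λ i → begin
        lincomb b a i
      ≡⟨ sym (M·X a i) ⟩
        (M · lincomb X a) i
      ≡⟨ M·-via-gram (lincomb X a) i ⟩
        coords i ∙ (λ j → X j ∙ (M · lincomb X a))
      ≡⟨ ∙-congʳ (coords i) (λ j → trans (sym (gram· a j)) (gram·a≐0 j)) ⟩
        coords i ∙ zeroV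
      ≡⟨ ∙-zeroʳ (coords i) ⟩
        false
      ∎ where open ≡-Reasoning

    weight-X : ∀ a → ⊕Σ (lincomb X a) ≡ a ∙ diagonal gram
    weight-X a = begin
        ⊕Σ (lincomb X a)
      ≡⟨ sym (quadratic-form-unitDiagonal M M-sym M-diag (lincomb X a)) ⟩
        lincomb X a ∙ (M · lincomb X a)
      ≡⟨ ∙-comm (lincomb X a) (M · lincomb X a) ⟩
        (M · lincomb X a) ∙ lincomb X a
      ≡⟨ ∙-lincomb (M · lincomb X a) X a ⟩
        ⊕Σ (λ j → a j ∧ (M · lincomb X a) ∙ X j)
      ≡⟨ ⊕Σ-cong (λ j → cong (a j ∧_) (trans (∙-comm (M · lincomb X a) (X j)) (sym (gram· a j)))) ⟩
        a ∙ (gram · a)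
      ≡⟨ quadratic-form gram gram-sym a ⟩
        a ∙ diagonal gram
      ∎ where open ≡-Reasoning

    -- X (coords i) and the unit vector eᵢ have the same image under M, so the same weight parity.
    coords-∙-diagonal : ∀ i → coords i ∙ diagonal gram ≡ true
    coords-∙-diagonal i = begin
        coords i ∙ diagonal gram
      ≡⟨ sym (weight-X (coords i)) ⟩
        ⊕Σ z
      ≡⟨ xor≡false⇒≡ (⊕Σ z) (⊕Σ (unitV i))
           (trans (sym (⊕Σ-xor z (unitV i))) (kernel-even M M-sym M-diag _ z+eᵢ∈ker)) ⟩
        ⊕Σ (unitV i)
      ≡⟨ ∙-unitV ones i ⟩
        true
      ∎
      where
        open ≡-Reasoning
        z = lincomb X (coords i)
        z+eᵢ∈ker : (M · (z +ᵥ unitV i)) ≐ zeroV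
        z+eᵢ∈ker w = trans (·-+ᵥ M z (unitV i) w)
          (trans (cong₂ _xor_ (trans (M·X (coords i) w) (trans (b-coords≐row i w) (M-sym i w))) (·-unitV M i w))
                 (xor-same (M w i)))

  OnesSolution-rankParity : OnesSolution M (⊕Σ {ρ} ones)
  OnesSolution-rankParity = lincomb X a , M·y≐ones , weight-y
    where
      open ≡-Reasoning
      a : Vec₂ ρ
      a = proj₁ (TrivialKernel⇒surjective gram gram-inj (diagonal gram))
      gram·a≐diag : (gram · a) ≐ diagonal gram
      gram·a≐diag = proj₂ (TrivialKernel⇒surjective gram gram-inj (diagonal gram))
      M·y≐ones : (M · lincomb X a) ≐ ones
      M·y≐ones i = begin
          (M · lincomb X a) i
        ≡⟨ M·-via-gram (lincomb X a) i ⟩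
          coords i ∙ (λ j → X j ∙ (M · lincomb X a))
        ≡⟨ ∙-congʳ (coords i) (λ j → trans (sym (gram· a j)) (gram·a≐diag j)) ⟩
          coords i ∙ diagonal gram
        ≡⟨ coords-∙-diagonal i ⟩
          true
        ∎
      weight-y : ⊕Σ (lincomb X a) ≡ ⊕Σ {ρ} ones
      weight-y = trans (weight-X a) (diagonal-solution-parity gram gram-sym gram-inj a gram·a≐diag)

bool→ℕ : Bool → ℕ
bool→ℕ true  = 1
bool→ℕ false = 0

Kernel-resp : (G : Graph) → Respects≐ (Kernel G)
Kernel-resp G x≐y Nx≐0 w = trans (sym (·-cong (N G) x≐y w)) (Nx≐0 w)

does-≟-injective : ∀ {m n} (f : Fin m → Fin n) → (∀ i j → f i ≡ f j → i ≡ j) →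
  ∀ i j → does (f i ≟ f j) ≡ does (i ≟ j)
does-≟-injective f f-inj i j with i ≟ j
... | yes refl = dec-true (f i ≟ f i) refl
... | no  i≢j  = dec-false (f i ≟ f j) (i≢j ∘ f-inj i j)

N-sym : (G : Graph) → IsSymmetric (N G)
N-sym G w i = cong₂ _∨_ (Graph.sym G w i) (unitV-sym i w)

N-diag : (G : Graph) → HasUnitDiagonal (N G)
N-diag G i = cong₂ _∨_ (irrefl G i) (unitV-diag i)

module Join₂ (G H : Graph) where

  private
    p = n G
    q = n H

    left : Vec₂ (p + q) → Vec₂ p
    left x = x ∘ (_↑ˡ q)

    right : Vec₂ (p + q) → Vec₂ q
    right x = x ∘ (p ↑ʳ_)

    NJ : Mat (p + q)
    NJ = N (G ⊕G H)

    NJ-ˡˡ : ∀ i i′ → NJ (i ↑ˡ q) (i′ ↑ˡ q) ≡ N G i i′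
    NJ-ˡˡ i i′ rewrite splitAt-↑ˡ p i q | splitAt-↑ˡ p i′ q =
      cong (adj G i i′ ∨_) (does-≟-injective (_↑ˡ q) (λ i j → ↑ˡ-injective q i j) i i′)

    NJ-ˡʳ : ∀ i j → NJ (i ↑ˡ q) (p ↑ʳ j) ≡ true
    NJ-ˡʳ i j rewrite splitAt-↑ˡ p i q | splitAt-↑ʳ p q j = refl

    NJ-ʳˡ : ∀ j i → NJ (p ↑ʳ j) (i ↑ˡ q) ≡ true
    NJ-ʳˡ j i rewrite splitAt-↑ˡ p i q | splitAt-↑ʳ p q j = refl

    NJ-ʳʳ : ∀ j j′ → NJ (p ↑ʳ j) (p ↑ʳ j′) ≡ N H j j′
    NJ-ʳʳ j j′ rewrite splitAt-↑ʳ p q j | splitAt-↑ʳ p q j′ =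
      cong (adj H j j′ ∨_) (does-≟-injective (p ↑ʳ_) (↑ʳ-injective p) j j′)

    NJ·-ˡ : ∀ x i → (NJ · x) (i ↑ˡ q) ≡ (N G · left x) i xor ⊕Σ (right x)
    NJ·-ˡ x i = trans (⊕Σ-++ {p} {q} (λ v → NJ (i ↑ˡ q) v ∧ x v))
      (cong₂ _xor_ (⊕Σ-cong (λ i′ → cong (_∧ x (i′ ↑ˡ q)) (NJ-ˡˡ i i′)))
                   (⊕Σ-cong (λ j → cong (_∧ x (p ↑ʳ j)) (NJ-ˡʳ i j))))

    NJ·-ʳ : ∀ x j → (NJ · x) (p ↑ʳ j) ≡ ⊕Σ (left x) xor (N H · right x) j
    NJ·-ʳ x j = trans (⊕Σ-++ {p} {q} (λ v → NJ (p ↑ʳ j) v ∧ x v))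
      (cong₂ _xor_ (⊕Σ-cong (λ i → cong (_∧ x (i ↑ˡ q)) (NJ-ʳˡ j i)))
                   (⊕Σ-cong (λ j′ → cong (_∧ x (p ↑ʳ j′)) (NJ-ʳʳ j j′))))

    ⊕Σ-++-split : ∀ (y₁ : Vec₂ p) (y₂ : Vec₂ q) → ⊕Σ (y₁ ++ y₂) ≡ ⊕Σ y₁ xor ⊕Σ y₂
    ⊕Σ-++-split y₁ y₂ = trans (⊕Σ-++ {p} {q} (y₁ ++ y₂))
      (cong₂ _xor_ (⊕Σ-cong (lookup-++ˡ y₁ y₂)) (⊕Σ-cong (lookup-++ʳ {m = p} y₁ y₂)))

    NJ·-++ : ∀ (y₁ : Vec₂ p) (y₂ : Vec₂ q) (t : Vec₂ (p + q)) →
      (∀ i → (N G · y₁) i xor ⊕Σ y₂ ≡ t (i ↑ˡ q)) → (∀ j → ⊕Σ y₁ xor (N H · y₂) j ≡ t (p ↑ʳ j)) →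
      (NJ · (y₁ ++ y₂)) ≐ t
    NJ·-++ y₁ y₂ t hˡ hʳ = ↑-elim
      (λ i → trans (NJ·-ˡ (y₁ ++ y₂) i)
        (trans (cong₂ _xor_ (·-cong (N G) (lookup-++ˡ y₁ y₂) i) (⊕Σ-cong (lookup-++ʳ {m = p} y₁ y₂))) (hˡ i)))
      (λ j → trans (NJ·-ʳ (y₁ ++ y₂) j)
        (trans (cong₂ _xor_ (⊕Σ-cong (lookup-++ˡ y₁ y₂)) (·-cong (N H) (lookup-++ʳ {m = p} y₁ y₂) j)) (hʳ j)))

    KernelProduct : Vec₂ (p + q) → Set
    KernelProduct x = Kernel G (left x) × Kernel H (right x)

    KernelProduct-dim : ∀ {ν₁ ν₂} → IsNullity G ν₁ → IsNullity H ν₂ → HasDim KernelProduct (ν₁ + ν₂)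
    KernelProduct-dim = HasDim-× (Kernel-resp G) (Kernel-resp H) (·-zero (N G)) (·-zero (N H))

    KernelProduct⊆Kernel : ∀ x → KernelProduct x → Kernel (G ⊕G H) x
    KernelProduct⊆Kernel x (x₁∈ker , x₂∈ker) = ↑-elim
      (λ i → trans (NJ·-ˡ x i) (cong₂ _xor_ (x₁∈ker i) (kernel-even (N H) (N-sym H) (N-diag H) _ x₂∈ker)))
      (λ j → trans (NJ·-ʳ x j) (cong₂ _xor_ (kernel-even (N G) (N-sym G) (N-diag G) _ x₁∈ker) (x₂∈ker j)))

    Kernel⇒ˡ : ∀ x → Kernel (G ⊕G H) x → ∀ i → (N G · left x) i ≡ ⊕Σ (right x)
    Kernel⇒ˡ x x∈ker i = xor≡false⇒≡ _ _ (trans (sym (NJ·-ˡ x i)) (x∈ker (i ↑ˡ q)))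

    Kernel⇒ʳ : ∀ x → Kernel (G ⊕G H) x → ∀ j → (N H · right x) j ≡ ⊕Σ (left x)
    Kernel⇒ʳ x x∈ker j = sym (xor≡false⇒≡ _ _ (trans (sym (NJ·-ʳ x j)) (x∈ker (p ↑ʳ j))))

    Kernel-cases : ∀ {s₁ s₂} → OnesSolution (N G) s₁ → OnesSolution (N H) s₂ → ∀ x → Kernel (G ⊕G H) x →
      KernelProduct x ⊎ (s₁ ≡ true × s₂ ≡ true × (N G · left x) ≐ ones × (N H · right x) ≐ ones)
    Kernel-cases {s₁} {s₂} sol₁ sol₂ x x∈ker = cases (⊕Σ (right x)) refl (⊕Σ (left x)) refl
      where
        Result : Set
        Result = KernelProduct x ⊎ (s₁ ≡ true × s₂ ≡ true × (N G · left x) ≐ ones × (N H · right x) ≐ ones)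
        cases : ∀ t₂ → ⊕Σ (right x) ≡ t₂ → ∀ t₁ → ⊕Σ (left x) ≡ t₁ → Result
        cases false ⊕Σx₂ _ _ =
          inj₁ (x₁∈ker , λ j → trans (Kernel⇒ʳ x x∈ker j)
                                     (kernel-even (N G) (N-sym G) (N-diag G) (left x) x₁∈ker))
          where
            x₁∈ker : Kernel G (left x)
            x₁∈ker i = trans (Kernel⇒ˡ x x∈ker i) ⊕Σx₂
        cases true ⊕Σx₂ false ⊕Σx₁ = ⊥-elim (not-¬ ⊕Σx₂≡0 ⊕Σx₂)
          where
            ⊕Σx₂≡0 : ⊕Σ (right x) ≡ false
            ⊕Σx₂≡0 = kernel-even (N H) (N-sym H) (N-diag H) (right x)
                                 (λ j → trans (Kernel⇒ʳ x x∈ker j) ⊕Σx₁)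
        cases true ⊕Σx₂ true ⊕Σx₁ =
          inj₂ ( trans (sym (OnesSolution-parity (N G) (N-sym G) (N-diag G) sol₁ (left x) N·x₁≐ones)) ⊕Σx₁
               , trans (sym (OnesSolution-parity (N H) (N-sym H) (N-diag H) sol₂ (right x) N·x₂≐ones)) ⊕Σx₂
               , N·x₁≐ones , N·x₂≐ones )
          where
            N·x₁≐ones : (N G · left x) ≐ ones
            N·x₁≐ones i = trans (Kernel⇒ˡ x x∈ker i) ⊕Σx₂
            N·x₂≐ones : (N H · right x) ≐ ones
            N·x₂≐ones j = trans (Kernel⇒ʳ x x∈ker j) ⊕Σx₁

    Kernel⊆KernelProduct : ∀ {s₁ s₂} → OnesSolution (N G) s₁ → OnesSolution (N H) s₂ →
      ¬ (s₁ ≡ true × s₂ ≡ true) → ∀ x → Kernel (G ⊕G H) x → KernelProduct x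
    Kernel⊆KernelProduct sol₁ sol₂ not-both x x∈ker with Kernel-cases sol₁ sol₂ x x∈ker
    ... | inj₁ x∈product = x∈product
    ... | inj₂ (s₁≡1 , s₂≡1 , _) = ⊥-elim (not-both (s₁≡1 , s₂≡1))

  OnesSolution-⊕G : ∀ {s₁ s₂} → OnesSolution (N G) s₁ → OnesSolution (N H) s₂ →
    OnesSolution (N (G ⊕G H)) (s₁ ∨ s₂)
  OnesSolution-⊕G {true} (y₁ , N·y₁≐1 , ⊕Σy₁) _ =
    y₁ ++ zeroV ,
    NJ·-++ y₁ zeroV ones (λ i → cong₂ _xor_ (N·y₁≐1 i) ⊕Σ0)
                         (λ j → cong₂ _xor_ ⊕Σy₁ (·-zero (N H) j)) ,
    trans (⊕Σ-++-split y₁ zeroV) (cong₂ _xor_ ⊕Σy₁ ⊕Σ0)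
    where ⊕Σ0 = ⊕Σ-zero {q} (λ _ → refl)
  OnesSolution-⊕G {false} {true} _ (y₂ , N·y₂≐1 , ⊕Σy₂) =
    zeroV ++ y₂ ,
    NJ·-++ zeroV y₂ ones (λ i → cong₂ _xor_ (·-zero (N G) i) ⊕Σy₂)
                         (λ j → cong₂ _xor_ ⊕Σ0 (N·y₂≐1 j)) ,
    trans (⊕Σ-++-split zeroV y₂) (cong₂ _xor_ ⊕Σ0 ⊕Σy₂)
    where ⊕Σ0 = ⊕Σ-zero {p} (λ _ → refl)
  OnesSolution-⊕G {false} {false} (y₁ , N·y₁≐1 , ⊕Σy₁) (y₂ , N·y₂≐1 , ⊕Σy₂) =
    y₁ ++ y₂ ,
    NJ·-++ y₁ y₂ ones (λ i → cong₂ _xor_ (N·y₁≐1 i) ⊕Σy₂)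
                      (λ j → cong₂ _xor_ ⊕Σy₁ (N·y₂≐1 j)) ,
    trans (⊕Σ-++-split y₁ y₂) (cong₂ _xor_ ⊕Σy₁ ⊕Σy₂)

  nullity-⊕G : ∀ {s₁ s₂ ν₁ ν₂} → OnesSolution (N G) s₁ → OnesSolution (N H) s₂ →
    IsNullity G ν₁ → IsNullity H ν₂ → IsNullity (G ⊕G H) (bool→ℕ (s₁ ∧ s₂) + (ν₁ + ν₂))
  nullity-⊕G {true} {true} sol₁@(y₁ , N·y₁≐1 , ⊕Σy₁) sol₂@(y₂ , N·y₂≐1 , ⊕Σy₂) dim₁ dim₂ =
    HasDim-suc u y (KernelProduct-dim dim₁ dim₂) KernelProduct⊆Kernel y∈ker u⊥product u∙y≡1 Kernel⊆
    where
      u y : Vec₂ (p + q)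
      u = ones {p} ++ zeroV {q}
      y = y₁ ++ y₂
      u∙≡⊕Σleft : ∀ x → u ∙ x ≡ ⊕Σ (left x)
      u∙≡⊕Σleft x = trans (⊕Σ-++ {p} {q} (λ w → u w ∧ x w))
        (trans (cong₂ _xor_ (⊕Σ-cong (λ i → cong (_∧ x (i ↑ˡ q)) (lookup-++ˡ ones zeroV i)))
                            (⊕Σ-zero (λ j → cong (_∧ x (p ↑ʳ j)) (lookup-++ʳ {m = p} ones zeroV j))))
               (xor-identityʳ _))
      u⊥product : ∀ x → KernelProduct x → u ∙ x ≡ false
      u⊥product x (x₁∈ker , _) = trans (u∙≡⊕Σleft x) (kernel-even (N G) (N-sym G) (N-diag G) (left x) x₁∈ker)
      u∙y≡1 : u ∙ y ≡ true
      u∙y≡1 = trans (u∙≡⊕Σleft y) (trans (⊕Σ-cong (lookup-++ˡ y₁ y₂)) ⊕Σy₁)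
      y∈ker : Kernel (G ⊕G H) y
      y∈ker = NJ·-++ y₁ y₂ zeroV (λ i → cong₂ _xor_ (N·y₁≐1 i) ⊕Σy₂)
                                 (λ j → cong₂ _xor_ ⊕Σy₁ (N·y₂≐1 j))
      Kernel⊆ : ∀ x → Kernel (G ⊕G H) x → KernelProduct x ⊎ KernelProduct (x +ᵥ y)
      Kernel⊆ x x∈ker with Kernel-cases sol₁ sol₂ x x∈ker
      ... | inj₁ x∈product = inj₁ x∈product
      ... | inj₂ (_ , _ , N·x₁≐1 , N·x₂≐1) = inj₂
        ( Kernel-resp G (λ i → cong (x (i ↑ˡ q) xor_) (sym (lookup-++ˡ y₁ y₂ i)))
                        (ones-solution-difference (N G) N·x₁≐1 N·y₁≐1)
        , Kernel-resp H (λ j → cong (x (p ↑ʳ j) xor_) (sym (lookup-++ʳ {m = p} y₁ y₂ j)))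
                        (ones-solution-difference (N H) N·x₂≐1 N·y₂≐1) )
  nullity-⊕G {true} {false} sol₁ sol₂ dim₁ dim₂ =
    HasDim-⇔ (Kernel⊆KernelProduct sol₁ sol₂ (λ ())) KernelProduct⊆Kernel (KernelProduct-dim dim₁ dim₂)
  nullity-⊕G {false} sol₁ sol₂ dim₁ dim₂ =
    HasDim-⇔ (Kernel⊆KernelProduct sol₁ sol₂ (λ ())) KernelProduct⊆Kernel (KernelProduct-dim dim₁ dim₂)

isPositive : ℕ → Bool
isPositive zero    = false
isPositive (suc _) = true

%2≡⊕Σ-ones : ∀ r → r % 2 ≡ bool→ℕ (⊕Σ {r} ones)
%2≡⊕Σ-ones zero          = refl
%2≡⊕Σ-ones (suc zero)    = refl
%2≡⊕Σ-ones (suc (suc r)) = trans (%2≡⊕Σ-ones r) (cong bool→ℕ (sym (not-involutive (⊕Σ {r} ones))))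

isPositive-+ : ∀ s j → isPositive (bool→ℕ s + j) ≡ s ∨ isPositive j
isPositive-+ true  j = refl
isPositive-+ false j = refl

nullity-count : ∀ s j ν₀ ν′ →
  bool→ℕ (s ∧ isPositive j) + (ν₀ + (ν′ + (j ∸ 1))) ≡ (ν₀ + ν′) + (bool→ℕ s + j ∸ 1)
nullity-count false j       ν₀ ν′ = sym (ℕ.+-assoc ν₀ ν′ (j ∸ 1))
nullity-count true  zero    ν₀ ν′ = sym (ℕ.+-assoc ν₀ ν′ 0)
nullity-count true  (suc j) ν₀ ν′ =
  trans (cong suc (sym (ℕ.+-assoc ν₀ ν′ j))) (sym (ℕ.+-suc (ν₀ + ν′) j))

emptyGraph-nullity : IsNullity emptyGraph 0
emptyGraph-nullity = (λ ()) , (λ ()) , (λ _ _ ()) , (λ _ _ → (λ ()) , (λ ()))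

Join-invariants : ∀ m (G : Fin m → Graph) (ρ ν : Fin m → ℕ) →
  (∀ i → IsRank (G i) (ρ i)) → (∀ i → IsNullity (G i) (ν i)) →
  OnesSolution (N (Join G)) (isPositive (oddCount ρ)) × IsNullity (Join G) (Σℕ ν + (oddCount ρ ∸ 1))
Join-invariants zero G ρ ν rank nullity = ((λ ()) , (λ ()) , refl) , emptyGraph-nullity
Join-invariants (suc m) G ρ ν rank nullity =
  subst (OnesSolution (N (Join G))) σ-eq (Join₂.OnesSolution-⊕G (G zero) (Join (G ∘ suc)) sol₀ sol′) ,
  subst (IsNullity (Join G)) ν-eq (Join₂.nullity-⊕G (G zero) (Join (G ∘ suc)) sol₀ sol′ (nullity zero) nullity′)
  where
    j = oddCount (ρ ∘ suc)
    s₀ = ⊕Σ {ρ zero} ones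
    sol₀ : OnesSolution (N (G zero)) s₀
    sol₀ = OnesSolution-rankParity (N (G zero)) (N-sym (G zero)) (N-diag (G zero)) (rank zero)
    IH = Join-invariants m (G ∘ suc) (ρ ∘ suc) (ν ∘ suc) (rank ∘ suc) (nullity ∘ suc)
    sol′ = proj₁ IH
    nullity′ = proj₂ IH
    σ-eq : s₀ ∨ isPositive j ≡ isPositive (ρ zero % 2 + j)
    σ-eq rewrite %2≡⊕Σ-ones (ρ zero) = sym (isPositive-+ s₀ j)
    ν-eq : bool→ℕ (s₀ ∧ isPositive j) + (ν zero + (Σℕ (ν ∘ suc) + (j ∸ 1)))
         ≡ Σℕ ν + (oddCount ρ ∸ 1)
    ν-eq rewrite %2≡⊕Σ-ones (ρ zero) = nullity-count s₀ j (ν zero) (Σℕ (ν ∘ suc))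

proposition3p7 : (m : ℕ) (G : Fin m → Graph) (ρ ν : Fin m → ℕ) (k : ℕ) →
    (∀ i → IsRank (G i) (ρ i)) → (∀ i → IsNullity (G i) (ν i)) →
    IsNullity (Join G) k →
    (oddCount ρ ≡ 0 → k ≡ Σℕ ν) ×
    (oddCount ρ ≢ 0 → k ≡ Σℕ ν + oddCount ρ ∸ 1)
proposition3p7 m G ρ ν k rank nullity nullity-k = no-odd , some-odd
  where
    k≡ : k ≡ Σℕ ν + (oddCount ρ ∸ 1)
    k≡ = HasDim-unique nullity-k (proj₂ (Join-invariants m G ρ ν rank nullity))
    no-odd : oddCount ρ ≡ 0 → k ≡ Σℕ ν
    no-odd j≡0 = trans k≡ (trans (cong (λ j → Σℕ ν + (j ∸ 1)) j≡0) (ℕ.+-identityʳ (Σℕ ν)))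
    some-odd : oddCount ρ ≢ 0 → k ≡ Σℕ ν + oddCount ρ ∸ 1
    some-odd j≢0 = trans k≡ (sym (ℕ.+-∸-assoc (Σℕ ν) (ℕ.n≢0⇒n>0 j≢0)))
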